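{- For every MV-algebra $A\in V(C)$, the structure $(\theta(A),\wedge,\vee,\odot,\oplus,0,1)$ is an $\ell$-bisemiring, and the assignment $A\mapsto\theta(A)$, sending each MV-algebra homomorphism $h:A\to B$ between algebras of $V(C)$ to its restriction $\theta(h):\theta(A)\to\theta(B)$, is a functor from $V(C)$ (as a category of MV-algebras and MV-homomorphisms) to the category $\ell BS$ of $\ell$-bisemirings. The same holds with $\theta^*$ in place of $\theta$.
   Context: An MV-algebra is a structure $(A,\oplus,\neg,0)$ where $(A,\oplus,0)$ is a commutative monoid, $\neg\neg x=x$, $x\oplus \neg 0=\neg 0$, and $\neg(\neg x\oplus y)\oplus y=\neg(\neg y\oplus x)\oplus x$; put $1=\neg 0$, $x\odot y=\neg(\neg x\oplus\neg y)$, $2x=x\oplus x$, $x^2=x\odot x$; $A$ is a lattice under $x\le y$ iff $y=x\oplus z$ for some $z$, with meet $\wedge$ and join $\vee$. $V(C)$ is the variety of MV-algebras generated by Chang's algebra $C=\Gamma(\mathbb Z\times_{lex}\mathbb Z,(1,0))$, axiomatized relative to MV-algebras by $(2x)^2=2(x^2)$. For $A\in V(C)$, $\theta(A)=\{x\in A: x\ge 2x^2\}$ and $\theta^*(A)=\{x\in A: x\le 2x^2\}$. An $\ell$-bisemiring is an algebra $(S,\wedge,\vee,\odot,\oplus,0,1)$ such that $(S,\wedge,\vee,0,1)$ is a bounded distributive lattice, $(S,\wedge,\oplus,0,1)$ is an idempotent commutative semiring (addition $\wedge$, multiplication $\oplus$), and $(S,\vee,\odot,0,1)$ is an idempotent commutative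 semiring (addition $\vee$, multiplication $\odot$); $\ell BS$ is the category of $\ell$-bisemirings with maps preserving $\wedge,\vee,\odot,\oplus,0,1$. -}

module Defs where

open import Level using (Level; _⊔_; suc)
open import Data.Product using (Σ; ∃; _×_; _,_; proj₁; proj₂)
open import Function using (_∘_)
open import Relation.Binary.Core using (Rel)
open import Relation.Binary.Structures using (IsEquivalence)
open import Algebra.Core using (Op₁; Op₂)
import Algebra.Definitions as AD
import Algebra.Structures as AS
import Algebra.Lattice.Structures as LS

record MVAlgebra (c ℓ : Level) : Set (suc (c ⊔ ℓ)) where
  infixl 6 _⊕_
  infix  8 ¬_
  infix  4 _≈_
  field
    Carrier : Set c
    _≈_     : Rel Carrier ℓ
    _⊕_     : Op₂ Carrier
    ¬_      : Op₁ Carrier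
    0#      : Carrier
    ⊕-isCommutativeMonoid : AS.IsCommutativeMonoid _≈_ _⊕_ 0#
    ¬-cong  : ∀ {x y} → x ≈ y → ¬ x ≈ ¬ y
    ¬¬-inv  : ∀ x → ¬ (¬ x) ≈ x
    ⊕-¬0    : ∀ x → x ⊕ ¬ 0# ≈ ¬ 0#
    łuk     : ∀ x y → ¬ (¬ x ⊕ y) ⊕ y ≈ ¬ (¬ y ⊕ x) ⊕ x

  open AS.IsCommutativeMonoid ⊕-isCommutativeMonoid public

  1# : Carrier
  1# = ¬ 0#

  infixl 7 _⊙_
  _⊙_ : Op₂ Carrier
  x ⊙ y = ¬ (¬ x ⊕ ¬ y)

  twice : Op₁ Carrier
  twice x = x ⊕ x

  sq : Op₁ Carrier
  sq x = x ⊙ x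

  infix 4 _≤_
  _≤_ : Rel Carrier (c ⊔ ℓ)
  x ≤ y = Σ Carrier λ z → y ≈ x ⊕ z

  infixr 5 _∨_ _∧_
  _∨_ : Op₂ Carrier
  x ∨ y = ¬ (¬ x ⊕ y) ⊕ y

  _∧_ : Op₂ Carrier
  x ∧ y = ¬ (¬ x ∨ ¬ y)

-- A belongs to V(C), the variety generated by Chang's algebra:
-- (2x)² = 2(x²) for all x.
InVC : ∀ {c ℓ} → MVAlgebra c ℓ → Set (c ⊔ ℓ)
InVC A = ∀ x → sq (twice x) ≈ twice (sq x)
  where open MVAlgebra A

θ : ∀ {c ℓ} (A : MVAlgebra c ℓ) → MVAlgebra.Carrier A → Set (c ⊔ ℓ)
θ A x = twice (sq x) ≤ x
  where open MVAlgebra A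

θ* : ∀ {c ℓ} (A : MVAlgebra c ℓ) → MVAlgebra.Carrier A → Set (c ⊔ ℓ)
θ* A x = x ≤ twice (sq x)
  where open MVAlgebra A

record IsMVHom {c ℓ c' ℓ'} (A : MVAlgebra c ℓ) (B : MVAlgebra c' ℓ')
               (f : MVAlgebra.Carrier A → MVAlgebra.Carrier B) : Set (c ⊔ ℓ ⊔ ℓ') where
  private
    module A = MVAlgebra A
    module B = MVAlgebra B
  field
    cong   : ∀ {x y} → x A.≈ y → f x B.≈ f y
    hom-⊕  : ∀ x y → f (x A.⊕ y) B.≈ f x B.⊕ f y
    hom-¬  : ∀ x → f (A.¬ x) B.≈ B.¬ (f x)
    hom-0  : f A.0# B.≈ B.0#

record LBSSig (c ℓ : Level) : Set (suc (c ⊔ ℓ)) where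
  infix 4 _≈_
  infixl 6 _∧_ _∨_ _⊙_ _⊕_
  field
    Carrier : Set c
    _≈_     : Rel Carrier ℓ
    _∧_ _∨_ _⊙_ _⊕_ : Op₂ Carrier
    0# 1#   : Carrier

record IsIdempotentCommutativeSemiring {c ℓ} {S : Set c} (_≈_ : Rel S ℓ)
         (+ * : Op₂ S) (0# 1# : S) : Set (c ⊔ ℓ) where
  field
    isIdempotentSemiring : AS.IsIdempotentSemiring _≈_ + * 0# 1#
    *-comm               : AD.Commutative _≈_ *

record IsLBisemiring {c ℓ} (S : LBSSig c ℓ) : Set (c ⊔ ℓ) where
  open LBSSig S
  field
    isDistributiveLattice : LS.IsDistributiveLattice _≈_ _∨_ _∧_
    ∨-identity            : AD.Identity _≈_ 0# _∨_
    ∧-identity            : AD.Identity _≈_ 1# _∧_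
    ∧⊕-semiring : IsIdempotentCommutativeSemiring _≈_ _∧_ _⊕_ 1# 0#
    ∨⊙-semiring : IsIdempotentCommutativeSemiring _≈_ _∨_ _⊙_ 0# 1#

record IsLBSHom {c ℓ c' ℓ'} (S : LBSSig c ℓ) (T : LBSSig c' ℓ')
                (f : LBSSig.Carrier S → LBSSig.Carrier T) : Set (c ⊔ ℓ ⊔ ℓ') where
  private
    module S = LBSSig S
    module T = LBSSig T
  field
    cong  : ∀ {x y} → x S.≈ y → f x T.≈ f y
    hom-∧ : ∀ x y → f (x S.∧ y) T.≈ f x T.∧ f y
    hom-∨ : ∀ x y → f (x S.∨ y) T.≈ f x T.∨ f y
    hom-⊙ : ∀ x y → f (x S.⊙ y) T.≈ f x T.⊙ f y
    hom-⊕ : ∀ x y → f (x S.⊕ y) T.≈ f x T.⊕ f y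
    hom-0 : f S.0# T.≈ T.0#
    hom-1 : f S.1# T.≈ T.1#

record Closed {c ℓ p} (A : MVAlgebra c ℓ) (P : MVAlgebra.Carrier A → Set p)
              : Set (c ⊔ p) where
  open MVAlgebra A
  field
    0∈ : P 0#
    1∈ : P 1#
    ∧∈ : ∀ {x y} → P x → P y → P (x ∧ y)
    ∨∈ : ∀ {x y} → P x → P y → P (x ∨ y)
    ⊙∈ : ∀ {x y} → P x → P y → P (x ⊙ y)
    ⊕∈ : ∀ {x y} → P x → P y → P (x ⊕ y)

Sub : ∀ {c ℓ p} (A : MVAlgebra c ℓ) (P : MVAlgebra.Carrier A → Set p) →
      Closed A P → LBSSig (c ⊔ p) ℓ
Sub A P cl = record
  { Carrier = Σ Carrier P
  ; _≈_     = λ x y → proj₁ x ≈ proj₁ y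
  ; _∧_     = λ x y → (proj₁ x ∧ proj₁ y , ∧∈ (proj₂ x) (proj₂ y))
  ; _∨_     = λ x y → (proj₁ x ∨ proj₁ y , ∨∈ (proj₂ x) (proj₂ y))
  ; _⊙_     = λ x y → (proj₁ x ⊙ proj₁ y , ⊙∈ (proj₂ x) (proj₂ y))
  ; _⊕_     = λ x y → (proj₁ x ⊕ proj₁ y , ⊕∈ (proj₂ x) (proj₂ y))
  ; 0#      = (0# , 0∈)
  ; 1#      = (1# , 1∈)
  }
  where
    open MVAlgebra A
    open Closed cl

MapsInto : ∀ {a b p q} {X : Set a} {Y : Set b} (P : X → Set p) (Q : Y → Set q) →
           (X → Y) → Set (a ⊔ p ⊔ q)
MapsInto P Q f = ∀ {x} → P x → Q (f x)

restrict : ∀ {a b p q} {X : Set a} {Y : Set b} {P : X → Set p} {Q : Y → Set q}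
           (f : X → Y) → MapsInto P Q f → Σ X P → Σ Y Q
restrict f m (x , px) = (f x , m px)

IsLBSFunctor : (c ℓ : Level) →
  (Θ : (A : MVAlgebra c ℓ) → MVAlgebra.Carrier A → Set (c ⊔ ℓ)) →
  Set (suc (c ⊔ ℓ))
IsLBSFunctor c ℓ Θ =
  (∀ (A : MVAlgebra c ℓ) → InVC A →
     Σ (Closed A (Θ A)) λ cl → IsLBisemiring (Sub A (Θ A) cl))
  ×
  (∀ (A B : MVAlgebra c ℓ) → InVC A → InVC B →
     (h : MVAlgebra.Carrier A → MVAlgebra.Carrier B) → IsMVHom A B h →
     Σ (MapsInto (Θ A) (Θ B) h) λ m →
       ∀ (clA : Closed A (Θ A)) (clB : Closed B (Θ B)) →
         IsLBSHom (Sub A (Θ A) clA) (Sub B (Θ B) clB) (restrict h m))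
  ×
  (∀ (A : MVAlgebra c ℓ) → InVC A →
     (m : MapsInto (Θ A) (Θ A) (λ x → x)) →
     ∀ (x : Σ (MVAlgebra.Carrier A) (Θ A)) →
       MVAlgebra._≈_ A (proj₁ (restrict {Q = Θ A} (λ x → x) m x)) (proj₁ x))
  ×
  (∀ (A B D : MVAlgebra c ℓ) → InVC A → InVC B → InVC D →
     (h : MVAlgebra.Carrier A → MVAlgebra.Carrier B) → IsMVHom A B h →
     (g : MVAlgebra.Carrier B → MVAlgebra.Carrier D) → IsMVHom B D g →
     (mh : MapsInto (Θ A) (Θ B) h) (mg : MapsInto (Θ B) (Θ D) g)
     (mgh : MapsInto (Θ A) (Θ D) (g ∘ h)) →
     ∀ (x : Σ (MVAlgebra.Carrier A) (Θ A)) →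
       MVAlgebra._≈_ D (proj₁ (restrict {Q = Θ D} (g ∘ h) mgh x))
                       (proj₁ (restrict {P = Θ B} {Q = Θ D} g mg
                                 (restrict {Q = Θ B} h mh x))))

-- In Chang's variety the element 2x² is Boolean: complementation turns it into
-- 2(¬x)², and doubling preserves the disjointness of x² and (¬x)².  As x ↦ 2x²
-- is moreover monotone, θ(A) = {x : 2x² ≤ x} is closed under ∧ and (Boolean
-- elements being idempotent) under ⊙; it is closed under ⊕ because x ↦ 2x² is
-- subadditive, and under ∨ because e ⊕ f ≤ e ∨ f for Boolean e.  Complementation
-- exchanges θ and θ*, so θ* is closed by De Morgan duality.  The ℓ-bisemiring
-- laws hold in every MV-algebra and restrict to any closed subset, while
-- MV-homomorphisms commute with x ↦ 2x² and preserve the order, hence map θ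
-- into θ and θ* into θ*; the functor laws then hold on the nose.

{-# OPTIONS --safe #-}
module Submission where

open import Defs
open import Level using (Level; _⊔_)
open import Data.Product using (_×_; Σ; _,_; proj₁; proj₂)
open import Algebra.Core using (Op₂)
open import Algebra.Bundles using (CommutativeSemigroup)
open import Algebra.Definitions using (Idempotent; Identity)
open import Algebra.Structures
  using (IsCommutativeMonoid; IsCommutativeSemiring; IsIdempotentSemiring)
open import Algebra.Lattice.Structures using (IsDistributiveLattice)
open import Algebra.Structures.Biased using (IsCommutativeSemiringˡ)
open import Relation.Binary.Core using (Rel)
import Relation.Binary.Construct.On as On
open import Relation.Binary.Definitions using (Minimum; Maximum)
open import Relation.Binary.Structures using (IsPartialOrder)
open import Relation.Binary.Bundles using (Poset)
open import Relation.Binary.Lattice.Definitions using (Supremum; Infimum)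
import Relation.Binary.Lattice.Structures as OrderLattice
import Relation.Binary.Lattice.Bundles as OrderLattice
import Relation.Binary.Lattice.Properties.Lattice as LatticeProperties
import Relation.Binary.Lattice.Properties.JoinSemilattice as JoinSemilatticeProperties
import Relation.Binary.Lattice.Properties.MeetSemilattice as MeetSemilatticeProperties
import Relation.Binary.Lattice.Properties.DistributiveLattice as DistributiveLatticeProperties
import Relation.Binary.Reasoning.Setoid as ≈-Reasoning
import Relation.Binary.Reasoning.PartialOrder as ≤-Reasoning
import Algebra.Properties.CommutativeSemigroup as CommutativeSemigroupProperties

isIdempotentCommutativeSemiringˡ :
  ∀ {a ℓ} {S : Set a} {_≈_ : Rel S ℓ} {_+_ _*_ : Op₂ S} {0# 1# : S} →
  IsCommutativeSemiringˡ _≈_ _+_ _*_ 0# 1# → Idempotent _≈_ _+_ →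
  IsIdempotentCommutativeSemiring _≈_ _+_ _*_ 0# 1#
isIdempotentCommutativeSemiringˡ isCSˡ +-idem = record
  { isIdempotentSemiring = record { isSemiring = isSemiring ; +-idem = +-idem }
  ; *-comm               = *-comm
  }
  where open IsCommutativeSemiring (IsCommutativeSemiringˡ.isCommutativeSemiring isCSˡ)

module Restriction {a ℓ p} {S : Set a} {_≈_ : Rel S ℓ} (P : S → Set p) where

  _≈ᴾ_ : Rel (Σ S P) ℓ
  x ≈ᴾ y = proj₁ x ≈ proj₁ y

  ClosedUnder : Op₂ S → Set (a ⊔ p)
  ClosedUnder _∙_ = ∀ {x y} → P x → P y → P (x ∙ y)

  restrictOp : (_∙_ : Op₂ S) → ClosedUnder _∙_ → Op₂ (Σ S P)
  restrictOp _∙_ ∙∈ x y = (proj₁ x ∙ proj₁ y , ∙∈ (proj₂ x) (proj₂ y))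

  identity : ∀ {_∙_ ε} (∙∈ : ClosedUnder _∙_) (ε∈ : P ε) →
             Identity _≈_ ε _∙_ → Identity _≈ᴾ_ (ε , ε∈) (restrictOp _∙_ ∙∈)
  identity _ _ (identityˡ , identityʳ) =
    (λ x → identityˡ (proj₁ x)) , (λ x → identityʳ (proj₁ x))

  isCommutativeMonoid : ∀ {_∙_ ε} → IsCommutativeMonoid _≈_ _∙_ ε →
    (∙∈ : ClosedUnder _∙_) (ε∈ : P ε) → IsCommutativeMonoid _≈ᴾ_ (restrictOp _∙_ ∙∈) (ε , ε∈)
  isCommutativeMonoid isCM ∙∈ ε∈ = record
    { isMonoid = record
      { isSemigroup = record
        { isMagma = record
          { isEquivalence = On.isEquivalence proj₁ isEquivalence ; ∙-cong = ∙-cong }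
        ; assoc   = λ x y z → assoc (proj₁ x) (proj₁ y) (proj₁ z)
        }
      ; identity = identity ∙∈ ε∈ (IsCommutativeMonoid.identity isCM)
      }
    ; comm = λ x y → comm (proj₁ x) (proj₁ y)
    }
    where open IsCommutativeMonoid isCM hiding (identity)

  isIdempotentCommutativeSemiring : ∀ {_+_ _*_ 0# 1#} →
    IsIdempotentCommutativeSemiring _≈_ _+_ _*_ 0# 1# →
    (+∈ : ClosedUnder _+_) (*∈ : ClosedUnder _*_) (0∈ : P 0#) (1∈ : P 1#) →
    IsIdempotentCommutativeSemiring _≈ᴾ_ (restrictOp _+_ +∈) (restrictOp _*_ *∈) (0# , 0∈) (1# , 1∈)
  isIdempotentCommutativeSemiring {_*_ = _*_} {1# = 1#} isICS +∈ *∈ 0∈ 1∈ =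
    isIdempotentCommutativeSemiringˡ (record
      { +-isCommutativeMonoid = isCommutativeMonoid +-isCommutativeMonoid +∈ 0∈
      ; *-isCommutativeMonoid = isCommutativeMonoid *-isCommutativeMonoid *∈ 1∈
      ; distribʳ = λ x y z → distribʳ (proj₁ x) (proj₁ y) (proj₁ z)
      ; zeroˡ    = λ x → zeroˡ (proj₁ x)
      }) (λ x → +-idem (proj₁ x))
    where
    open IsIdempotentCommutativeSemiring isICS using (*-comm; isIdempotentSemiring)
    open IsIdempotentSemiring isIdempotentSemiring
    *-isCommutativeMonoid : IsCommutativeMonoid _≈_ _*_ 1#
    *-isCommutativeMonoid = record { isMonoid = *-isMonoid ; comm = *-comm }

  isDistributiveLattice : ∀ {_∨_ _∧_} → IsDistributiveLattice _≈_ _∨_ _∧_ →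
    (∨∈ : ClosedUnder _∨_) (∧∈ : ClosedUnder _∧_) →
    IsDistributiveLattice _≈ᴾ_ (restrictOp _∨_ ∨∈) (restrictOp _∧_ ∧∈)
  isDistributiveLattice isDL ∨∈ ∧∈ = record
    { isLattice = record
      { isEquivalence = On.isEquivalence proj₁ isEquivalence
      ; ∨-comm  = λ x y → ∨-comm (proj₁ x) (proj₁ y)
      ; ∨-assoc = λ x y z → ∨-assoc (proj₁ x) (proj₁ y) (proj₁ z)
      ; ∨-cong  = ∨-cong
      ; ∧-comm  = λ x y → ∧-comm (proj₁ x) (proj₁ y)
      ; ∧-assoc = λ x y z → ∧-assoc (proj₁ x) (proj₁ y) (proj₁ z)
      ; ∧-cong  = ∧-cong
      ; absorptive = (λ x y → ∨-absorbs-∧ (proj₁ x) (proj₁ y))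
                   , (λ x y → ∧-absorbs-∨ (proj₁ x) (proj₁ y))
      }
    ; ∨-distrib-∧ = (λ x y z → ∨-distribˡ-∧ (proj₁ x) (proj₁ y) (proj₁ z))
                  , (λ x y z → ∨-distribʳ-∧ (proj₁ x) (proj₁ y) (proj₁ z))
    ; ∧-distrib-∨ = (λ x y z → ∧-distribˡ-∨ (proj₁ x) (proj₁ y) (proj₁ z))
                  , (λ x y z → ∧-distribʳ-∨ (proj₁ x) (proj₁ y) (proj₁ z))
    }
    where open IsDistributiveLattice isDL

module MVProperties {c ℓ} (A : MVAlgebra c ℓ) where

  open MVAlgebra A public
    renaming ( assoc to ⊕-assoc; comm to ⊕-comm
             ; identityˡ to ⊕-identityˡ; identityʳ to ⊕-identityʳ
             ; ∙-cong to ⊕-cong; ∙-congˡ to ⊕-congˡ; ∙-congʳ to ⊕-congʳ )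

  ⊕-commutativeSemigroup : CommutativeSemigroup c ℓ
  ⊕-commutativeSemigroup = record { isCommutativeSemigroup = isCommutativeSemigroup }

  open CommutativeSemigroupProperties ⊕-commutativeSemigroup
    using () renaming (x∙yz≈y∙xz to ⊕-x∙yz≈y∙xz; xy∙z≈y∙xz to ⊕-xy∙z≈y∙xz)

  ¬-injective : ∀ {x y} → ¬ x ≈ ¬ y → x ≈ y
  ¬-injective {x} {y} ¬x≈¬y = trans (sym (¬¬-inv x)) (trans (¬-cong ¬x≈¬y) (¬¬-inv y))

  ¬1≈0 : ¬ 1# ≈ 0#
  ¬1≈0 = ¬¬-inv 0#

  ⊕-zeroʳ : ∀ x → x ⊕ 1# ≈ 1#
  ⊕-zeroʳ = ⊕-¬0

  ⊕-zeroˡ : ∀ x → 1# ⊕ x ≈ 1#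
  ⊕-zeroˡ x = trans (⊕-comm 1# x) (⊕-zeroʳ x)

  ¬1⊕x≈x : ∀ x → ¬ 1# ⊕ x ≈ x
  ¬1⊕x≈x x = trans (⊕-congʳ ¬1≈0) (⊕-identityˡ x)

  ⊕-complementˡ : ∀ x → ¬ x ⊕ x ≈ 1#
  ⊕-complementˡ x = begin
    ¬ x ⊕ x               ≈⟨ ⊕-congʳ (¬-cong (¬1⊕x≈x x)) ⟨
    ¬ (¬ 1# ⊕ x) ⊕ x      ≈⟨ łuk 1# x ⟩
    ¬ (¬ x ⊕ 1#) ⊕ 1#     ≈⟨ ⊕-zeroʳ _ ⟩
    1#                    ∎
    where open ≈-Reasoning setoid

  ⊕-complementʳ : ∀ x → x ⊕ ¬ x ≈ 1#
  ⊕-complementʳ x = trans (⊕-comm x (¬ x)) (⊕-complementˡ x)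

  ⊙-cong : ∀ {x y u v} → x ≈ y → u ≈ v → x ⊙ u ≈ y ⊙ v
  ⊙-cong x≈y u≈v = ¬-cong (⊕-cong (¬-cong x≈y) (¬-cong u≈v))

  ¬-⊙ : ∀ x y → ¬ (x ⊙ y) ≈ ¬ x ⊕ ¬ y
  ¬-⊙ x y = ¬¬-inv _

  ¬-⊕ : ∀ x y → ¬ (x ⊕ y) ≈ ¬ x ⊙ ¬ y
  ¬-⊕ x y = ¬-cong (sym (⊕-cong (¬¬-inv x) (¬¬-inv y)))

  ⊙-isCommutativeMonoid : IsCommutativeMonoid _≈_ _⊙_ 1#
  ⊙-isCommutativeMonoid = record
    { isMonoid = record
      { isSemigroup = record
        { isMagma = record { isEquivalence = isEquivalence ; ∙-cong = ⊙-cong }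
        ; assoc   = λ x y z → ¬-cong (trans (⊕-congʳ (¬¬-inv _))
                                 (trans (⊕-assoc _ _ _) (⊕-congˡ (sym (¬¬-inv _)))))
        }
      ; identity = (λ x → trans (¬-cong (¬1⊕x≈x (¬ x))) (¬¬-inv x))
                 , (λ x → trans (¬-cong (trans (⊕-congˡ ¬1≈0) (⊕-identityʳ _))) (¬¬-inv x))
      }
    ; comm = λ x y → ¬-cong (⊕-comm (¬ x) (¬ y))
    }

  open IsCommutativeMonoid ⊙-isCommutativeMonoid public
    using () renaming ( assoc to ⊙-assoc; comm to ⊙-comm
                      ; identityʳ to ⊙-identityʳ )

  ⊙-commutativeSemigroup : CommutativeSemigroup c ℓ
  ⊙-commutativeSemigroup = record
    { isCommutativeSemigroup = IsCommutativeMonoid.isCommutativeSemigroup ⊙-isCommutativeMonoid }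

  open CommutativeSemigroupProperties ⊙-commutativeSemigroup
    using () renaming (interchange to ⊙-interchange)

  ⊙-zeroʳ : ∀ x → x ⊙ 0# ≈ 0#
  ⊙-zeroʳ x = trans (¬-cong (⊕-zeroʳ _)) ¬1≈0

  ⊙-zeroˡ : ∀ x → 0# ⊙ x ≈ 0#
  ⊙-zeroˡ x = trans (⊙-comm 0# x) (⊙-zeroʳ x)

  ⊙-complementʳ : ∀ x → x ⊙ ¬ x ≈ 0#
  ⊙-complementʳ x = trans (¬-cong (trans (⊕-congˡ (¬¬-inv x)) (⊕-complementˡ x))) ¬1≈0

  ≤-reflexive : ∀ {x y} → x ≈ y → x ≤ y
  ≤-reflexive {x} x≈y = 0# , trans (sym x≈y) (sym (⊕-identityʳ x))

  ≤-trans : ∀ {x y z} → x ≤ y → y ≤ z → x ≤ z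
  ≤-trans {x} (u , y≈x⊕u) (v , z≈y⊕v) =
    u ⊕ v , trans z≈y⊕v (trans (⊕-congʳ y≈x⊕u) (⊕-assoc x u v))

  ≤⇒¬⊕≈1 : ∀ {x y} → x ≤ y → ¬ x ⊕ y ≈ 1#
  ≤⇒¬⊕≈1 {x} {y} (z , y≈x⊕z) = begin
    ¬ x ⊕ y          ≈⟨ ⊕-congˡ y≈x⊕z ⟩
    ¬ x ⊕ (x ⊕ z)    ≈⟨ ⊕-assoc _ _ _ ⟨
    (¬ x ⊕ x) ⊕ z    ≈⟨ ⊕-congʳ (⊕-complementˡ x) ⟩
    1# ⊕ z           ≈⟨ ⊕-zeroˡ z ⟩
    1#               ∎
    where open ≈-Reasoning setoid

  ¬⊕≈1⇒≤ : ∀ {x y} → ¬ x ⊕ y ≈ 1# → x ≤ y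
  ¬⊕≈1⇒≤ {x} {y} ¬x⊕y≈1 = ¬ (¬ y ⊕ x) , (begin
    y                  ≈⟨ ¬1⊕x≈x y ⟨
    ¬ 1# ⊕ y           ≈⟨ ⊕-congʳ (¬-cong ¬x⊕y≈1) ⟨
    ¬ (¬ x ⊕ y) ⊕ y    ≈⟨ łuk x y ⟩
    ¬ (¬ y ⊕ x) ⊕ x    ≈⟨ ⊕-comm _ _ ⟩
    x ⊕ ¬ (¬ y ⊕ x)    ∎)
    where open ≈-Reasoning setoid

  ≤⇒∨≈ : ∀ {x y} → x ≤ y → x ∨ y ≈ y
  ≤⇒∨≈ {x} {y} x≤y =
    trans (⊕-congʳ (trans (¬-cong (≤⇒¬⊕≈1 x≤y)) ¬1≈0)) (⊕-identityˡ y)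

  ≤-antisym : ∀ {x y} → x ≤ y → y ≤ x → x ≈ y
  ≤-antisym {x} {y} x≤y y≤x = trans (sym (≤⇒∨≈ y≤x)) (trans (łuk y x) (≤⇒∨≈ x≤y))

  ≤-isPartialOrder : IsPartialOrder _≈_ _≤_
  ≤-isPartialOrder = record
    { isPreorder = record
      { isEquivalence = isEquivalence ; reflexive = ≤-reflexive ; trans = ≤-trans }
    ; antisym = ≤-antisym
    }

  ≤-poset : Poset c ℓ (c ⊔ ℓ)
  ≤-poset = record { isPartialOrder = ≤-isPartialOrder }

  ≤-refl : ∀ {x} → x ≤ x
  ≤-refl = ≤-reflexive refl

  x≤x⊕y : ∀ x y → x ≤ x ⊕ y
  x≤x⊕y x y = y , refl

  y≤x⊕y : ∀ x y → y ≤ x ⊕ y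
  y≤x⊕y x y = x , ⊕-comm x y

  0#-minimum : Minimum _≤_ 0#
  0#-minimum x = x , sym (⊕-identityˡ x)

  1#-maximum : Maximum _≤_ 1#
  1#-maximum x = ¬ x , sym (⊕-complementʳ x)

  ⊕-monoˡ-≤ : ∀ z {x y} → x ≤ y → x ⊕ z ≤ y ⊕ z
  ⊕-monoˡ-≤ z {x} {y} (u , y≈x⊕u) = u , (begin
    y ⊕ z          ≈⟨ ⊕-congʳ y≈x⊕u ⟩
    (x ⊕ u) ⊕ z    ≈⟨ ⊕-assoc x u z ⟩
    x ⊕ (u ⊕ z)    ≈⟨ ⊕-congˡ (⊕-comm u z) ⟩
    x ⊕ (z ⊕ u)    ≈⟨ ⊕-assoc x z u ⟨
    (x ⊕ z) ⊕ u    ∎)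
    where open ≈-Reasoning setoid

  ⊕-monoʳ-≤ : ∀ z {x y} → x ≤ y → z ⊕ x ≤ z ⊕ y
  ⊕-monoʳ-≤ z {x} {y} x≤y = begin
    z ⊕ x   ≈⟨ ⊕-comm z x ⟩
    x ⊕ z   ≤⟨ ⊕-monoˡ-≤ z x≤y ⟩
    y ⊕ z   ≈⟨ ⊕-comm y z ⟩
    z ⊕ y   ∎
    where open ≤-Reasoning ≤-poset

  ⊕-mono-≤ : ∀ {x y u v} → x ≤ y → u ≤ v → x ⊕ u ≤ y ⊕ v
  ⊕-mono-≤ {y = y} {u} x≤y u≤v = ≤-trans (⊕-monoˡ-≤ u x≤y) (⊕-monoʳ-≤ y u≤v)

  ¬-antimono-≤ : ∀ {x y} → x ≤ y → ¬ y ≤ ¬ x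
  ¬-antimono-≤ {x} {y} x≤y =
    ¬⊕≈1⇒≤ (trans (⊕-congʳ (¬¬-inv y)) (trans (⊕-comm y (¬ x)) (≤⇒¬⊕≈1 x≤y)))

  ¬-cancel-≤ : ∀ {x y} → ¬ x ≤ ¬ y → y ≤ x
  ¬-cancel-≤ {x} {y} ¬x≤¬y = begin
    y       ≈⟨ ¬¬-inv y ⟨
    ¬ ¬ y   ≤⟨ ¬-antimono-≤ ¬x≤¬y ⟩
    ¬ ¬ x   ≈⟨ ¬¬-inv x ⟩
    x       ∎
    where open ≤-Reasoning ≤-poset

  ⊙-monoˡ-≤ : ∀ z {x y} → x ≤ y → x ⊙ z ≤ y ⊙ z
  ⊙-monoˡ-≤ z x≤y = ¬-antimono-≤ (⊕-monoˡ-≤ (¬ z) (¬-antimono-≤ x≤y))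

  ⊙-monoʳ-≤ : ∀ z {x y} → x ≤ y → z ⊙ x ≤ z ⊙ y
  ⊙-monoʳ-≤ z x≤y = ¬-antimono-≤ (⊕-monoʳ-≤ (¬ z) (¬-antimono-≤ x≤y))

  ⊙-mono-≤ : ∀ {x y u v} → x ≤ y → u ≤ v → x ⊙ u ≤ y ⊙ v
  ⊙-mono-≤ {y = y} {u} x≤y u≤v = ≤-trans (⊙-monoˡ-≤ u x≤y) (⊙-monoʳ-≤ y u≤v)

  x⊙y≤x : ∀ x y → x ⊙ y ≤ x
  x⊙y≤x x y = ¬-cancel-≤ (≤-trans (x≤x⊕y (¬ x) (¬ y)) (≤-reflexive (sym (¬¬-inv _))))

  x⊙y≤y : ∀ x y → x ⊙ y ≤ y
  x⊙y≤y x y = ≤-trans (≤-reflexive (⊙-comm x y)) (x⊙y≤x y x)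

  ⊙≤⇒≤¬⊕ : ∀ {x y z} → x ⊙ y ≤ z → y ≤ ¬ x ⊕ z
  ⊙≤⇒≤¬⊕ {x} {y} {z} x⊙y≤z =
    ¬⊕≈1⇒≤ (trans (⊕-x∙yz≈y∙xz (¬ y) (¬ x) z)
      (trans (sym (⊕-assoc _ _ z)) (trans (⊕-congʳ (sym (¬-⊙ x y))) (≤⇒¬⊕≈1 x⊙y≤z))))

  ≤¬⊕⇒⊙≤ : ∀ {x y z} → y ≤ ¬ x ⊕ z → x ⊙ y ≤ z
  ≤¬⊕⇒⊙≤ {x} {y} {z} y≤¬x⊕z =
    ¬⊕≈1⇒≤ (trans (⊕-congʳ (¬-⊙ x y))
             (trans (⊕-xy∙z≈y∙xz (¬ x) (¬ y) z) (≤⇒¬⊕≈1 y≤¬x⊕z)))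

  x⊙[¬x⊕y]≤y : ∀ x y → x ⊙ (¬ x ⊕ y) ≤ y
  x⊙[¬x⊕y]≤y x y = ≤¬⊕⇒⊙≤ ≤-refl

  ∨-supremum : Supremum _≤_ _∨_
  ∨-supremum x y = x≤x∨y , y≤x∨y , ∨-least
    where
    x≤x∨y : x ≤ x ∨ y
    x≤x∨y = ¬ (¬ y ⊕ x) , trans (łuk x y) (⊕-comm _ _)
    y≤x∨y : y ≤ x ∨ y
    y≤x∨y = ¬ (¬ x ⊕ y) , ⊕-comm _ _
    ∨-least : ∀ z → x ≤ z → y ≤ z → x ∨ y ≤ z
    ∨-least z x≤z y≤z = begin
      ¬ (¬ x ⊕ y) ⊕ y   ≤⟨ ⊕-monoˡ-≤ y (¬-antimono-≤ (⊕-monoˡ-≤ y (¬-antimono-≤ x≤z))) ⟩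
      z ∨ y             ≈⟨ łuk z y ⟩
      y ∨ z             ≈⟨ ≤⇒∨≈ y≤z ⟩
      z                 ∎
      where open ≤-Reasoning ≤-poset

  ¬-∨ : ∀ x y → ¬ (x ∨ y) ≈ ¬ x ∧ ¬ y
  ¬-∨ x y = ¬-cong (sym (⊕-cong (¬-cong (⊕-cong (¬¬-inv (¬ x)) (¬¬-inv y))) (¬¬-inv y)))

  ¬-∧ : ∀ x y → ¬ (x ∧ y) ≈ ¬ x ∨ ¬ y
  ¬-∧ x y = ¬¬-inv _

  ∧-infimum : Infimum _≤_ _∧_
  ∧-infimum x y = x∧y≤x , x∧y≤y , ∧-greatest
    where
    dual = ∨-supremum (¬ x) (¬ y)
    x∧y≤x : x ∧ y ≤ x
    x∧y≤x = ¬-cancel-≤ (≤-trans (proj₁ dual) (≤-reflexive (sym (¬-∧ x y))))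
    x∧y≤y : x ∧ y ≤ y
    x∧y≤y = ¬-cancel-≤ (≤-trans (proj₁ (proj₂ dual)) (≤-reflexive (sym (¬-∧ x y))))
    ∧-greatest : ∀ z → z ≤ x → z ≤ y → z ≤ x ∧ y
    ∧-greatest z z≤x z≤y = ¬-cancel-≤ (≤-trans (≤-reflexive (¬-∧ x y))
      (proj₂ (proj₂ dual) (¬ z) (¬-antimono-≤ z≤x) (¬-antimono-≤ z≤y)))

  isLattice : OrderLattice.IsLattice _≈_ _≤_ _∨_ _∧_
  isLattice = record
    { isPartialOrder = ≤-isPartialOrder ; supremum = ∨-supremum ; infimum = ∧-infimum }

  lattice : OrderLattice.Lattice c ℓ (c ⊔ ℓ)
  lattice = record { isLattice = isLattice }

  open OrderLattice.IsLattice isLattice public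
    using (x≤x∨y; y≤x∨y; ∨-least; x∧y≤x; x∧y≤y; ∧-greatest)
  open JoinSemilatticeProperties (OrderLattice.Lattice.joinSemilattice lattice) public
    using (∨-monotonic; ∨-cong; ∨-comm; ∨-assoc; ∨-idempotent)
  open MeetSemilatticeProperties (OrderLattice.Lattice.meetSemilattice lattice) public
    using (∧-monotonic; ∧-cong; ∧-comm; ∧-assoc; ∧-idempotent; y≤x⇒x∧y≈y)
  open LatticeProperties lattice public
    using (isAlgLattice)

  ∨-identityˡ : ∀ x → 0# ∨ x ≈ x
  ∨-identityˡ x = ≤⇒∨≈ (0#-minimum x)

  ∨-identityʳ : ∀ x → x ∨ 0# ≈ x
  ∨-identityʳ x = trans (∨-comm x 0#) (∨-identityˡ x)

  ∧-identityˡ : ∀ x → 1# ∧ x ≈ x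
  ∧-identityˡ x = y≤x⇒x∧y≈y (1#-maximum x)

  ∧-identityʳ : ∀ x → x ∧ 1# ≈ x
  ∧-identityʳ x = trans (∧-comm x 1#) (∧-identityˡ x)

  ⊙-distribˡ-∨ : ∀ x y z → x ⊙ (y ∨ z) ≈ (x ⊙ y) ∨ (x ⊙ z)
  ⊙-distribˡ-∨ x y z = ≤-antisym
    (≤¬⊕⇒⊙≤ (∨-least (⊙≤⇒≤¬⊕ (x≤x∨y _ _)) (⊙≤⇒≤¬⊕ (y≤x∨y _ _))))
    (∨-least (⊙-monoʳ-≤ x (x≤x∨y y z)) (⊙-monoʳ-≤ x (y≤x∨y y z)))

  ⊙-distribʳ-∨ : ∀ x y z → (y ∨ z) ⊙ x ≈ (y ⊙ x) ∨ (z ⊙ x)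
  ⊙-distribʳ-∨ x y z =
    trans (⊙-comm _ x) (trans (⊙-distribˡ-∨ x y z) (∨-cong (⊙-comm x y) (⊙-comm x z)))

  ⊕-distribˡ-∧ : ∀ x y z → x ⊕ (y ∧ z) ≈ (x ⊕ y) ∧ (x ⊕ z)
  ⊕-distribˡ-∧ x y z = ¬-injective (begin
    ¬ (x ⊕ (y ∧ z))                 ≈⟨ ¬-⊕ x _ ⟩
    ¬ x ⊙ ¬ (y ∧ z)                 ≈⟨ ⊙-cong refl (¬-∧ y z) ⟩
    ¬ x ⊙ (¬ y ∨ ¬ z)               ≈⟨ ⊙-distribˡ-∨ _ _ _ ⟩
    (¬ x ⊙ ¬ y) ∨ (¬ x ⊙ ¬ z)       ≈⟨ ∨-cong (¬-⊕ x y) (¬-⊕ x z) ⟨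
    ¬ (x ⊕ y) ∨ ¬ (x ⊕ z)           ≈⟨ ¬-∧ _ _ ⟨
    ¬ ((x ⊕ y) ∧ (x ⊕ z))           ∎)
    where open ≈-Reasoning setoid

  ⊕-distribʳ-∧ : ∀ x y z → (y ∧ z) ⊕ x ≈ (y ⊕ x) ∧ (z ⊕ x)
  ⊕-distribʳ-∧ x y z =
    trans (⊕-comm _ x) (trans (⊕-distribˡ-∧ x y z) (∧-cong (⊕-comm x y) (⊕-comm x z)))

  x∧y≈x⊙[¬x⊕y] : ∀ x y → x ∧ y ≈ x ⊙ (¬ x ⊕ y)
  x∧y≈x⊙[¬x⊕y] x y = ¬-cong (begin
    ¬ (¬ ¬ x ⊕ ¬ y) ⊕ ¬ y     ≈⟨ łuk (¬ x) (¬ y) ⟩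
    ¬ (¬ ¬ y ⊕ ¬ x) ⊕ ¬ x     ≈⟨ ⊕-comm _ _ ⟩
    ¬ x ⊕ ¬ (¬ ¬ y ⊕ ¬ x)     ≈⟨ ⊕-congˡ (¬-cong (trans (⊕-congʳ (¬¬-inv y)) (⊕-comm y _))) ⟩
    ¬ x ⊕ ¬ (¬ x ⊕ y)         ∎)
    where open ≈-Reasoning setoid

  -- a ∨ b ≈ 1 once ¬ a ⊕ b ≈ b.  Here ¬ a = w is absorbed by ¬ y ⊕ x because
  -- x = (x ∧ y) ⊕ w while ¬ y already absorbs x ∧ y ≤ y.
  prelinearity : ∀ x y → (¬ x ⊕ y) ∨ (¬ y ⊕ x) ≈ 1#
  prelinearity x y = begin
    ¬ (¬ (¬ x ⊕ y) ⊕ (¬ y ⊕ x)) ⊕ (¬ y ⊕ x)   ≈⟨ ⊕-congʳ (¬-cong absorbed) ⟩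
    ¬ (¬ y ⊕ x) ⊕ (¬ y ⊕ x)                   ≈⟨ ⊕-complementˡ _ ⟩
    1#                                        ∎
    where
    open ≈-Reasoning setoid
    w = ¬ (¬ x ⊕ y)
    w≤x : w ≤ x
    w≤x = ≤-trans (¬-antimono-≤ (x≤x⊕y (¬ x) y)) (≤-reflexive (¬¬-inv x))
    x∧y⊕w≈x : (x ∧ y) ⊕ w ≈ x
    x∧y⊕w≈x = begin
      (x ∧ y) ⊕ w               ≈⟨ ⊕-congʳ (x∧y≈x⊙[¬x⊕y] x y) ⟩
      ¬ (¬ x ⊕ w) ⊕ w           ≈⟨ łuk x w ⟩
      w ∨ x                     ≈⟨ ≤⇒∨≈ w≤x ⟩
      x                         ∎
    ¬y⊕x∧y≈¬y⊕x : ¬ y ⊕ (x ∧ y) ≈ ¬ y ⊕ x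
    ¬y⊕x∧y≈¬y⊕x = begin
      ¬ y ⊕ (x ∧ y)             ≈⟨ ⊕-distribˡ-∧ (¬ y) x y ⟩
      (¬ y ⊕ x) ∧ (¬ y ⊕ y)     ≈⟨ ∧-cong refl (⊕-complementˡ y) ⟩
      (¬ y ⊕ x) ∧ 1#            ≈⟨ ∧-identityʳ _ ⟩
      ¬ y ⊕ x                   ∎
    absorbed : w ⊕ (¬ y ⊕ x) ≈ ¬ y ⊕ x
    absorbed = begin
      w ⊕ (¬ y ⊕ x)             ≈⟨ ⊕-congˡ ¬y⊕x∧y≈¬y⊕x ⟨
      w ⊕ (¬ y ⊕ (x ∧ y))       ≈⟨ ⊕-x∙yz≈y∙xz w (¬ y) _ ⟩
      ¬ y ⊕ (w ⊕ (x ∧ y))       ≈⟨ ⊕-congˡ (trans (⊕-comm w _) x∧y⊕w≈x) ⟩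
      ¬ y ⊕ x                   ∎

  ≤-by-cover : ∀ {u v m t} → 1# ≤ u ∨ v → m ⊙ u ≤ t → m ⊙ v ≤ t → m ≤ t
  ≤-by-cover {u} {v} {m} {t} 1≤u∨v m⊙u≤t m⊙v≤t = begin
    m                    ≈⟨ ⊙-identityʳ m ⟨
    m ⊙ 1#               ≤⟨ ⊙-monoʳ-≤ m 1≤u∨v ⟩
    m ⊙ (u ∨ v)          ≈⟨ ⊙-distribˡ-∨ m u v ⟩
    (m ⊙ u) ∨ (m ⊙ v)    ≤⟨ ∨-least m⊙u≤t m⊙v≤t ⟩
    t                    ∎
    where open ≤-Reasoning ≤-poset

  ≤-by-prelinearity : ∀ x y {m t} → m ⊙ (¬ x ⊕ y) ≤ t → m ⊙ (¬ y ⊕ x) ≤ t → m ≤ t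
  ≤-by-prelinearity x y = ≤-by-cover (≤-reflexive (sym (prelinearity x y)))

  ∧-distribˡ-∨ : ∀ x y z → x ∧ (y ∨ z) ≈ (x ∧ y) ∨ (x ∧ z)
  ∧-distribˡ-∨ x y z = ≤-antisym
    (≤-by-prelinearity y z
      (≤-trans (localise (x∧y≤y x _)) (y≤x∨y _ _))
      (≤-trans (localise (≤-trans (x∧y≤y x _) (≤-reflexive (∨-comm y z)))) (x≤x∨y _ _)))
    (∨-least (∧-monotonic ≤-refl (x≤x∨y y z)) (∧-monotonic ≤-refl (y≤x∨y y z)))
    where
    m = x ∧ (y ∨ z)
    localise : ∀ {u v} → m ≤ u ∨ v → m ⊙ (¬ u ⊕ v) ≤ x ∧ v
    localise m≤u∨v = ∧-greatest (≤-trans (x⊙y≤x m _) (x∧y≤x x _))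
                                (≤-trans (≤-reflexive (⊙-comm m _)) (≤¬⊕⇒⊙≤ m≤u∨v))

  isDistributiveLattice : OrderLattice.IsDistributiveLattice _≈_ _≤_ _∨_ _∧_
  isDistributiveLattice = record { isLattice = isLattice ; ∧-distribˡ-∨ = ∧-distribˡ-∨ }

  distributiveLattice : OrderLattice.DistributiveLattice c ℓ (c ⊔ ℓ)
  distributiveLattice = record { isDistributiveLattice = isDistributiveLattice }

  open DistributiveLatticeProperties distributiveLattice public
    using (∨-distrib-∧; ∧-distrib-∨)

  reduct : LBSSig c ℓ
  reduct = record
    { Carrier = Carrier ; _≈_ = _≈_ ; _∧_ = _∧_ ; _∨_ = _∨_ ; _⊙_ = _⊙_ ; _⊕_ = _⊕_
    ; 0# = 0# ; 1# = 1# }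

  isLBisemiring : IsLBisemiring reduct
  isLBisemiring = record
    { isDistributiveLattice = record
      { isLattice = isAlgLattice ; ∨-distrib-∧ = ∨-distrib-∧ ; ∧-distrib-∨ = ∧-distrib-∨ }
    ; ∨-identity  = ∨-identityˡ , ∨-identityʳ
    ; ∧-identity  = ∧-identityˡ , ∧-identityʳ
    ; ∧⊕-semiring = isIdempotentCommutativeSemiringˡ (record
      { +-isCommutativeMonoid = ∧-isCommutativeMonoid
      ; *-isCommutativeMonoid = ⊕-isCommutativeMonoid
      ; distribʳ = ⊕-distribʳ-∧
      ; zeroˡ    = ⊕-zeroˡ
      }) ∧-idempotent
    ; ∨⊙-semiring = isIdempotentCommutativeSemiringˡ (record
      { +-isCommutativeMonoid = ∨-isCommutativeMonoid
      ; *-isCommutativeMonoid = ⊙-isCommutativeMonoid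
      ; distribʳ = ⊙-distribʳ-∨
      ; zeroˡ    = ⊙-zeroˡ
      }) ∨-idempotent
    }
    where
    ∧-isCommutativeMonoid : IsCommutativeMonoid _≈_ _∧_ 1#
    ∧-isCommutativeMonoid = record
      { isMonoid = record
        { isSemigroup = record
          { isMagma = record { isEquivalence = isEquivalence ; ∙-cong = ∧-cong }
          ; assoc = ∧-assoc }
        ; identity = ∧-identityˡ , ∧-identityʳ }
      ; comm = ∧-comm }
    ∨-isCommutativeMonoid : IsCommutativeMonoid _≈_ _∨_ 0#
    ∨-isCommutativeMonoid = record
      { isMonoid = record
        { isSemigroup = record
          { isMagma = record { isEquivalence = isEquivalence ; ∙-cong = ∨-cong }
          ; assoc = ∨-assoc }
        ; identity = ∨-identityˡ , ∨-identityʳ }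
      ; comm = ∨-comm }

  ⊙≤0⇒≤¬ : ∀ {x y} → x ⊙ y ≤ 0# → y ≤ ¬ x
  ⊙≤0⇒≤¬ {x} x⊙y≤0 = ≤-trans (⊙≤⇒≤¬⊕ x⊙y≤0) (≤-reflexive (⊕-identityʳ (¬ x)))

  x⊙[y⊕z]≤y⊕x⊙z : ∀ x y z → x ⊙ (y ⊕ z) ≤ y ⊕ (x ⊙ z)
  x⊙[y⊕z]≤y⊕x⊙z x y z = ≤¬⊕⇒⊙≤ (begin
    y ⊕ z                 ≤⟨ ⊕-monoʳ-≤ y (⊙≤⇒≤¬⊕ ≤-refl) ⟩
    y ⊕ (¬ x ⊕ x ⊙ z)     ≈⟨ ⊕-x∙yz≈y∙xz y (¬ x) _ ⟩
    ¬ x ⊕ (y ⊕ x ⊙ z)     ∎)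
    where open ≤-Reasoning ≤-poset

  x∧[y⊕z]≤x∧y⊕x∧z : ∀ x y z → x ∧ (y ⊕ z) ≤ (x ∧ y) ⊕ (x ∧ z)
  x∧[y⊕z]≤x∧y⊕x∧z x y z = begin
    x ∧ (y ⊕ z)
      ≤⟨ ∧-greatest (∧-greatest (m≤x⊕ x) (m≤x⊕ z)) (∧-greatest m≤y⊕x (x∧y≤y x _)) ⟩
    ((x ⊕ x) ∧ (x ⊕ z)) ∧ ((y ⊕ x) ∧ (y ⊕ z))
      ≈⟨ ∧-cong (⊕-distribˡ-∧ x x z) (⊕-distribˡ-∧ y x z) ⟨
    (x ⊕ (x ∧ z)) ∧ (y ⊕ (x ∧ z))
      ≈⟨ ⊕-distribʳ-∧ (x ∧ z) x y ⟨
    (x ∧ y) ⊕ (x ∧ z)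
      ∎
    where
    open ≤-Reasoning ≤-poset
    m≤x⊕ : ∀ u → x ∧ (y ⊕ z) ≤ x ⊕ u
    m≤x⊕ u = ≤-trans (x∧y≤x x _) (x≤x⊕y x u)
    m≤y⊕x : x ∧ (y ⊕ z) ≤ y ⊕ x
    m≤y⊕x = ≤-trans (x∧y≤x x _) (y≤x⊕y y x)

  ⊕-≤0 : ∀ {x y} → x ≤ 0# → y ≤ 0# → x ⊕ y ≤ 0#
  ⊕-≤0 x≤0 y≤0 = ≤-trans (⊕-mono-≤ x≤0 y≤0) (≤-reflexive (⊕-identityʳ 0#))

  twice-≤0 : ∀ {x} → x ≤ 0# → twice x ≤ 0#
  twice-≤0 x≤0 = ⊕-≤0 x≤0 x≤0

  ∧-⊕-≤0 : ∀ {x y z} → x ∧ y ≤ 0# → x ∧ z ≤ 0# → x ∧ (y ⊕ z) ≤ 0#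
  ∧-⊕-≤0 {x} {y} {z} x∧y≤0 x∧z≤0 =
    ≤-trans (x∧[y⊕z]≤x∧y⊕x∧z x y z) (⊕-≤0 x∧y≤0 x∧z≤0)

  twice-∧-≤0 : ∀ {x y} → x ∧ y ≤ 0# → twice x ∧ twice y ≤ 0#
  twice-∧-≤0 {x} {y} x∧y≤0 = ∧-⊕-≤0 (swap y∧2x≤0) (swap y∧2x≤0)
    where
    swap : ∀ {u v} → u ∧ v ≤ 0# → v ∧ u ≤ 0#
    swap u∧v≤0 = ≤-trans (≤-reflexive (∧-comm _ _)) u∧v≤0
    y∧2x≤0 : y ∧ twice x ≤ 0#
    y∧2x≤0 = ∧-⊕-≤0 (swap x∧y≤0) (swap x∧y≤0)

  ⊙∧¬⊙≈0 : ∀ x y → (x ⊙ y) ∧ (¬ x ⊙ ¬ y) ≈ 0#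
  ⊙∧¬⊙≈0 x y = begin
    ¬ (¬ (x ⊙ y) ∨ ¬ (¬ x ⊙ ¬ y))     ≈⟨ ¬-cong (∨-cong (¬-⊙ x y) (¬-⊙ (¬ x) (¬ y))) ⟩
    ¬ ((¬ x ⊕ ¬ y) ∨ (¬ ¬ x ⊕ ¬ ¬ y)) ≈⟨ ¬-cong (∨-cong refl ¬¬x⊕¬¬y≈) ⟩
    ¬ ((¬ x ⊕ ¬ y) ∨ (¬ ¬ y ⊕ x))     ≈⟨ ¬-cong (prelinearity x (¬ y)) ⟩
    ¬ 1#                              ≈⟨ ¬1≈0 ⟩
    0#                                ∎
    where
    open ≈-Reasoning setoid
    ¬¬x⊕¬¬y≈ : ¬ ¬ x ⊕ ¬ ¬ y ≈ ¬ ¬ y ⊕ x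
    ¬¬x⊕¬¬y≈ = trans (⊕-congʳ (¬¬-inv x)) (⊕-comm x _)

  sq-mono-≤ : ∀ {x y} → x ≤ y → sq x ≤ sq y
  sq-mono-≤ x≤y = ⊙-mono-≤ x≤y x≤y

  twice-sq-cong : ∀ {x y} → x ≈ y → twice (sq x) ≈ twice (sq y)
  twice-sq-cong x≈y = ⊕-cong (⊙-cong x≈y x≈y) (⊙-cong x≈y x≈y)

  twice-sq-mono-≤ : ∀ {x y} → x ≤ y → twice (sq x) ≤ twice (sq y)
  twice-sq-mono-≤ x≤y = ⊕-mono-≤ (sq-mono-≤ x≤y) (sq-mono-≤ x≤y)

  ⊙≤sq∨sq : ∀ x y → x ⊙ y ≤ sq x ∨ sq y
  ⊙≤sq∨sq x y = ≤-by-prelinearity x y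
    (begin
      (x ⊙ y) ⊙ (¬ x ⊕ y)   ≈⟨ ⊙-cong (⊙-comm x y) refl ⟩
      (y ⊙ x) ⊙ (¬ x ⊕ y)   ≈⟨ ⊙-assoc y x _ ⟩
      y ⊙ (x ⊙ (¬ x ⊕ y))   ≤⟨ ⊙-monoʳ-≤ y (x⊙[¬x⊕y]≤y x y) ⟩
      sq y                  ≤⟨ y≤x∨y _ _ ⟩
      sq x ∨ sq y           ∎)
    (begin
      (x ⊙ y) ⊙ (¬ y ⊕ x)   ≈⟨ ⊙-assoc x y _ ⟩
      x ⊙ (y ⊙ (¬ y ⊕ x))   ≤⟨ ⊙-monoʳ-≤ x (x⊙[¬x⊕y]≤y y x) ⟩
      sq x                  ≤⟨ x≤x∨y _ _ ⟩
      sq x ∨ sq y           ∎)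
    where open ≤-Reasoning ≤-poset

  sq-∨ : ∀ x y → sq (x ∨ y) ≤ sq x ∨ sq y
  sq-∨ x y = begin
    (x ∨ y) ⊙ (x ∨ y)                      ≈⟨ ⊙-distribʳ-∨ _ x y ⟩
    (x ⊙ (x ∨ y)) ∨ (y ⊙ (x ∨ y))          ≈⟨ ∨-cong (⊙-distribˡ-∨ x x y) (⊙-distribˡ-∨ y x y) ⟩
    (sq x ∨ (x ⊙ y)) ∨ ((y ⊙ x) ∨ sq y)    ≤⟨ ∨-least (∨-least (x≤x∨y _ _) (⊙≤sq∨sq x y))
                                                      (∨-least y⊙x≤ (y≤x∨y _ _)) ⟩
    sq x ∨ sq y                            ∎
    where
    open ≤-Reasoning ≤-poset
    y⊙x≤ : y ⊙ x ≤ sq x ∨ sq y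
    y⊙x≤ = ≤-trans (≤-reflexive (⊙-comm y x)) (⊙≤sq∨sq x y)

  sq-¬⊙-≤0 : ∀ {e x} → sq x ≤ e → sq (¬ e ⊙ x) ≤ 0#
  sq-¬⊙-≤0 {e} {x} sqx≤e = begin
    sq (¬ e ⊙ x)        ≈⟨ ⊙-interchange (¬ e) x (¬ e) x ⟩
    sq (¬ e) ⊙ sq x     ≤⟨ ⊙-mono-≤ (x⊙y≤x (¬ e) (¬ e)) sqx≤e ⟩
    ¬ e ⊙ e             ≈⟨ ⊙-comm (¬ e) e ⟩
    e ⊙ ¬ e             ≈⟨ ⊙-complementʳ e ⟩
    0#                  ∎
    where open ≤-Reasoning ≤-poset

  ≤sq-⊙ : ∀ {x y} → x ≤ sq x → y ≤ sq y → x ⊙ y ≤ sq (x ⊙ y)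
  ≤sq-⊙ {x} {y} x≤sqx y≤sqy =
    ≤-trans (⊙-mono-≤ x≤sqx y≤sqy) (≤-reflexive (⊙-interchange x x y y))

  ≤sq⇒⊙-subdistrib-⊕ : ∀ {e} → e ≤ sq e → ∀ u v → e ⊙ (u ⊕ v) ≤ (e ⊙ u) ⊕ (e ⊙ v)
  ≤sq⇒⊙-subdistrib-⊕ {e} e≤sqe u v = begin
    e ⊙ (u ⊕ v)             ≤⟨ ⊙-monoˡ-≤ _ e≤sqe ⟩
    sq e ⊙ (u ⊕ v)          ≈⟨ ⊙-assoc e e _ ⟩
    e ⊙ (e ⊙ (u ⊕ v))       ≤⟨ ⊙-monoʳ-≤ e (x⊙[y⊕z]≤y⊕x⊙z e u v) ⟩
    e ⊙ (u ⊕ (e ⊙ v))       ≈⟨ ⊙-cong refl (⊕-comm u _) ⟩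
    e ⊙ ((e ⊙ v) ⊕ u)       ≤⟨ x⊙[y⊕z]≤y⊕x⊙z e _ u ⟩
    (e ⊙ v) ⊕ (e ⊙ u)       ≈⟨ ⊕-comm _ _ ⟩
    (e ⊙ u) ⊕ (e ⊙ v)       ∎
    where open ≤-Reasoning ≤-poset

  ≤sq⇒⊙-twice-sq : ∀ {e} → e ≤ sq e → ∀ x → e ⊙ twice (sq x) ≤ twice (sq (e ⊙ x))
  ≤sq⇒⊙-twice-sq {e} e≤sqe x = begin
    e ⊙ twice (sq x)                  ≤⟨ ≤sq⇒⊙-subdistrib-⊕ e≤sqe (sq x) (sq x) ⟩
    twice (e ⊙ sq x)                  ≤⟨ ⊕-mono-≤ e⊙sqx≤ e⊙sqx≤ ⟩
    twice (sq (e ⊙ x))                ∎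
    where
    open ≤-Reasoning ≤-poset
    e⊙sqx≤ : e ⊙ sq x ≤ sq (e ⊙ x)
    e⊙sqx≤ = ≤-trans (⊙-monoˡ-≤ (sq x) e≤sqe) (≤-reflexive (⊙-interchange e e x x))

  IsBoolean : Carrier → Set (c ⊔ ℓ)
  IsBoolean e = e ∧ ¬ e ≤ 0#

  IsBoolean-¬ : ∀ {e} → IsBoolean e → IsBoolean (¬ e)
  IsBoolean-¬ {e} e∧¬e≤0 =
    ≤-trans (≤-reflexive (trans (∧-cong refl (¬¬-inv e)) (∧-comm (¬ e) e))) e∧¬e≤0

  IsBoolean⇒1≤∨¬ : ∀ {e} → IsBoolean e → 1# ≤ e ∨ ¬ e
  IsBoolean⇒1≤∨¬ {e} e∧¬e≤0 = ¬-cancel-≤ (begin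
    ¬ (e ∨ ¬ e)     ≈⟨ ¬-∨ e (¬ e) ⟩
    ¬ e ∧ ¬ ¬ e     ≈⟨ trans (∧-cong refl (¬¬-inv e)) (∧-comm (¬ e) e) ⟩
    e ∧ ¬ e         ≤⟨ e∧¬e≤0 ⟩
    0#              ≈⟨ ¬1≈0 ⟨
    ¬ 1#            ∎)
    where open ≤-Reasoning ≤-poset

  IsBoolean⇒≤sq : ∀ {e} → IsBoolean e → e ≤ sq e
  IsBoolean⇒≤sq {e} isBoolean = ≤-by-cover (IsBoolean⇒1≤∨¬ isBoolean)
    ≤-refl (≤-trans (≤-reflexive (⊙-complementʳ e)) (0#-minimum _))

  IsBoolean⇒⊕≤∨ : ∀ {e} → IsBoolean e → ∀ f → e ⊕ f ≤ e ∨ f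
  IsBoolean⇒⊕≤∨ {e} isBoolean f = ≤-by-cover (IsBoolean⇒1≤∨¬ isBoolean)
    (≤-trans (x⊙y≤y _ e) (x≤x∨y e f))
    (≤-trans (≤-trans (≤-reflexive (⊙-comm _ (¬ e)))
                      (≤¬⊕⇒⊙≤ (⊕-monoˡ-≤ f (≤-reflexive (sym (¬¬-inv e))))))
             (y≤x∨y e f))

module ChangVariety {c ℓ} (A : MVAlgebra c ℓ) (inVC : InVC A) where

  open MVProperties A

  ¬-twice-sq : ∀ x → ¬ twice (sq x) ≈ twice (sq (¬ x))
  ¬-twice-sq x = begin
    ¬ twice (sq x)              ≈⟨ ¬-⊕ (sq x) (sq x) ⟩
    sq (¬ sq x)                 ≈⟨ ⊙-cong (¬-⊙ x x) (¬-⊙ x x) ⟩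
    sq (twice (¬ x))            ≈⟨ inVC (¬ x) ⟩
    twice (sq (¬ x))            ∎
    where open ≈-Reasoning setoid

  twice-sq-isBoolean : ∀ x → IsBoolean (twice (sq x))
  twice-sq-isBoolean x = ≤-trans (≤-reflexive (∧-cong refl (¬-twice-sq x)))
    (twice-∧-≤0 (≤-reflexive (⊙∧¬⊙≈0 x x)))

  sq-⊕-≤0 : ∀ {x y} → sq x ≤ 0# → sq y ≤ 0# → sq (x ⊕ y) ≤ 0#
  sq-⊕-≤0 {x} {y} sqx≤0 sqy≤0 = begin
    sq (x ⊕ y)                ≤⟨ sq-mono-≤ (⊕-mono-≤ (x≤x∨y x y) (y≤x∨y x y)) ⟩
    sq (twice (x ∨ y))        ≈⟨ inVC (x ∨ y) ⟩
    twice (sq (x ∨ y))        ≤⟨ twice-≤0 (≤-trans (sq-∨ x y) (∨-least sqx≤0 sqy≤0)) ⟩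
    0#                        ∎
    where open ≤-Reasoning ≤-poset

  -- Cut x ⊕ y by the idempotent t = ¬ 2x² ⊙ ¬ 2y²: both t ⊙ x and t ⊙ y square to 0.
  twice-sq-subadditive : ∀ x y → twice (sq (x ⊕ y)) ≤ twice (sq x) ⊕ twice (sq y)
  twice-sq-subadditive x y = ≤-trans (⊙≤0⇒≤¬ t⊙g≤0)
    (≤-reflexive (trans (¬-⊙ (¬ e) (¬ f)) (⊕-cong (¬¬-inv e) (¬¬-inv f))))
    where
    open ≤-Reasoning ≤-poset
    e = twice (sq x)
    f = twice (sq y)
    t = ¬ e ⊙ ¬ f
    t≤sqt : t ≤ sq t
    t≤sqt = ≤sq-⊙ (IsBoolean⇒≤sq (IsBoolean-¬ (twice-sq-isBoolean x)))
                  (IsBoolean⇒≤sq (IsBoolean-¬ (twice-sq-isBoolean y)))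
    sq[t⊙x]≤0 : sq (t ⊙ x) ≤ 0#
    sq[t⊙x]≤0 = ≤-trans (sq-mono-≤ (⊙-monoˡ-≤ x (x⊙y≤x (¬ e) (¬ f))))
                        (sq-¬⊙-≤0 (x≤x⊕y (sq x) (sq x)))
    sq[t⊙y]≤0 : sq (t ⊙ y) ≤ 0#
    sq[t⊙y]≤0 = ≤-trans (sq-mono-≤ (⊙-monoˡ-≤ y (x⊙y≤y (¬ e) (¬ f))))
                        (sq-¬⊙-≤0 (x≤x⊕y (sq y) (sq y)))
    t⊙g≤0 : t ⊙ twice (sq (x ⊕ y)) ≤ 0#
    t⊙g≤0 = begin
      t ⊙ twice (sq (x ⊕ y))              ≤⟨ ≤sq⇒⊙-twice-sq t≤sqt (x ⊕ y) ⟩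
      twice (sq (t ⊙ (x ⊕ y)))            ≤⟨ ⊕-mono-≤ (sq-mono-≤ split) (sq-mono-≤ split) ⟩
      twice (sq ((t ⊙ x) ⊕ (t ⊙ y)))      ≤⟨ twice-≤0 (sq-⊕-≤0 sq[t⊙x]≤0 sq[t⊙y]≤0) ⟩
      0#                                  ∎
      where
      split : t ⊙ (x ⊕ y) ≤ (t ⊙ x) ⊕ (t ⊙ y)
      split = ≤sq⇒⊙-subdistrib-⊕ t≤sqt x y

  θ-resp-≈ : ∀ {x y} → x ≈ y → θ A x → θ A y
  θ-resp-≈ {x} {y} x≈y θx = begin
    twice (sq y)   ≈⟨ twice-sq-cong x≈y ⟨
    twice (sq x)   ≤⟨ θx ⟩
    x              ≈⟨ x≈y ⟩
    y              ∎
    where open ≤-Reasoning ≤-poset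

  θ-closed : Closed A (θ A)
  θ-closed = record
    { 0∈ = 0∈ ; 1∈ = 1#-maximum _ ; ∧∈ = ∧∈ ; ∨∈ = ∨∈ ; ⊙∈ = ⊙∈ ; ⊕∈ = ⊕∈ }
    where
    open ≤-Reasoning ≤-poset
    0∈ : θ A 0#
    0∈ = twice-≤0 (≤-reflexive (⊙-zeroʳ 0#))
    ∧∈ : ∀ {x y} → θ A x → θ A y → θ A (x ∧ y)
    ∧∈ {x} {y} θx θy = ∧-greatest (≤-trans (twice-sq-mono-≤ (x∧y≤x x y)) θx)
                                  (≤-trans (twice-sq-mono-≤ (x∧y≤y x y)) θy)
    ⊕∈ : ∀ {x y} → θ A x → θ A y → θ A (x ⊕ y)
    ⊕∈ {x} {y} θx θy = ≤-trans (twice-sq-subadditive x y) (⊕-mono-≤ θx θy)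
    ∨∈ : ∀ {x y} → θ A x → θ A y → θ A (x ∨ y)
    ∨∈ {x} {y} θx θy = begin
      twice (sq (x ∨ y))                ≤⟨ twice-sq-mono-≤ (∨-least (x≤x⊕y x y) (y≤x⊕y x y)) ⟩
      twice (sq (x ⊕ y))                ≤⟨ twice-sq-subadditive x y ⟩
      twice (sq x) ⊕ twice (sq y)       ≤⟨ IsBoolean⇒⊕≤∨ (twice-sq-isBoolean x) _ ⟩
      twice (sq x) ∨ twice (sq y)       ≤⟨ ∨-monotonic θx θy ⟩
      x ∨ y                             ∎
    ⊙∈ : ∀ {x y} → θ A x → θ A y → θ A (x ⊙ y)
    ⊙∈ {x} {y} θx θy = begin
      twice (sq (x ⊙ y))                ≤⟨ IsBoolean⇒≤sq (twice-sq-isBoolean (x ⊙ y)) ⟩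
      sq (twice (sq (x ⊙ y)))           ≤⟨ ⊙-mono-≤ (twice-sq-mono-≤ (x⊙y≤x x y))
                                                    (twice-sq-mono-≤ (x⊙y≤y x y)) ⟩
      twice (sq x) ⊙ twice (sq y)       ≤⟨ ⊙-mono-≤ θx θy ⟩
      x ⊙ y                             ∎

  θ*⇒¬θ : ∀ {x} → θ* A x → θ A (¬ x)
  θ*⇒¬θ {x} θ*x = ≤-trans (≤-reflexive (sym (¬-twice-sq x))) (¬-antimono-≤ θ*x)

  ¬θ⇒θ* : ∀ {x} → θ A (¬ x) → θ* A x
  ¬θ⇒θ* {x} θ¬x = begin
    x                     ≈⟨ ¬¬-inv x ⟨
    ¬ ¬ x                 ≤⟨ ¬-antimono-≤ θ¬x ⟩
    ¬ twice (sq (¬ x))    ≈⟨ ¬-twice-sq (¬ x) ⟩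
    twice (sq (¬ ¬ x))    ≈⟨ twice-sq-cong (¬¬-inv x) ⟩
    twice (sq x)          ∎
    where open ≤-Reasoning ≤-poset

  θ*-closed : Closed A (θ* A)
  θ*-closed = record
    { 0∈ = ¬θ⇒θ* 1∈
    ; 1∈ = ¬θ⇒θ* (θ-resp-≈ (sym ¬1≈0) 0∈)
    ; ∧∈ = λ {x} {y} → dual (¬-∧ x y) ∨∈
    ; ∨∈ = λ {x} {y} → dual (¬-∨ x y) ∧∈
    ; ⊙∈ = λ {x} {y} → dual (¬-⊙ x y) ⊕∈
    ; ⊕∈ = λ {x} {y} → dual (¬-⊕ x y) ⊙∈
    }
    where
    open Closed θ-closed
    dual : ∀ {x y z u} → ¬ z ≈ u →
           (θ A (¬ x) → θ A (¬ y) → θ A u) → θ* A x → θ* A y → θ* A z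
    dual ¬z≈ closed θ*x θ*y = ¬θ⇒θ* (θ-resp-≈ (sym ¬z≈) (closed (θ*⇒¬θ θ*x) (θ*⇒¬θ θ*y)))

Sub-isLBisemiring : ∀ {c ℓ p} (A : MVAlgebra c ℓ) {P : MVAlgebra.Carrier A → Set p}
                    (cl : Closed A P) → IsLBisemiring (Sub A P cl)
Sub-isLBisemiring A {P} cl = record
  { isDistributiveLattice = R.isDistributiveLattice isDistributiveLattice ∨∈ ∧∈
  ; ∨-identity  = R.identity ∨∈ 0∈ ∨-identity
  ; ∧-identity  = R.identity ∧∈ 1∈ ∧-identity
  ; ∧⊕-semiring = R.isIdempotentCommutativeSemiring ∧⊕-semiring ∧∈ ⊕∈ 1∈ 0∈
  ; ∨⊙-semiring = R.isIdempotentCommutativeSemiring ∨⊙-semiring ∨∈ ⊙∈ 0∈ 1∈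
  }
  where
  open IsLBisemiring (MVProperties.isLBisemiring A)
  open Closed cl
  module R = Restriction P

module MVHomomorphism
  {c ℓ c′ ℓ′} {A : MVAlgebra c ℓ} {B : MVAlgebra c′ ℓ′}
  {h : MVAlgebra.Carrier A → MVAlgebra.Carrier B} (isMVHom : IsMVHom A B h) where

  private
    module A = MVProperties A
    module B = MVProperties B
  open IsMVHom isMVHom

  hom-1 : h A.1# B.≈ B.1#
  hom-1 = B.trans (hom-¬ A.0#) (B.¬-cong hom-0)

  hom-⊙ : ∀ x y → h (x A.⊙ y) B.≈ h x B.⊙ h y
  hom-⊙ x y = B.trans (hom-¬ _) (B.¬-cong (B.trans (hom-⊕ _ _) (B.⊕-cong (hom-¬ x) (hom-¬ y))))

  hom-∨ : ∀ x y → h (x A.∨ y) B.≈ h x B.∨ h y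
  hom-∨ x y = B.trans (hom-⊕ _ _)
    (B.⊕-congʳ (B.trans (hom-¬ _) (B.¬-cong (B.trans (hom-⊕ _ _) (B.⊕-congʳ (hom-¬ x))))))

  hom-∧ : ∀ x y → h (x A.∧ y) B.≈ h x B.∧ h y
  hom-∧ x y = B.trans (hom-¬ _) (B.¬-cong (B.trans (hom-∨ _ _) (B.∨-cong (hom-¬ x) (hom-¬ y))))

  hom-twice-sq : ∀ x → h (A.twice (A.sq x)) B.≈ B.twice (B.sq (h x))
  hom-twice-sq x = B.trans (hom-⊕ _ _) (B.⊕-cong (hom-⊙ x x) (hom-⊙ x x))

  mono-≤ : ∀ {x y} → x A.≤ y → h x B.≤ h y
  mono-≤ (z , y≈x⊕z) = h z , B.trans (cong y≈x⊕z) (hom-⊕ _ _)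

  θ-preserved : MapsInto (θ A) (θ B) h
  θ-preserved θx = B.≤-trans (B.≤-reflexive (B.sym (hom-twice-sq _))) (mono-≤ θx)

  θ*-preserved : MapsInto (θ* A) (θ* B) h
  θ*-preserved θ*x = B.≤-trans (mono-≤ θ*x) (B.≤-reflexive (hom-twice-sq _))

  restrict-isLBSHom : ∀ {p q} {P : A.Carrier → Set p} {Q : B.Carrier → Set q}
    (m : MapsInto P Q h) (clA : Closed A P) (clB : Closed B Q) →
    IsLBSHom (Sub A P clA) (Sub B Q clB) (restrict h m)
  restrict-isLBSHom m clA clB = record
    { cong  = cong
    ; hom-∧ = λ x y → hom-∧ (proj₁ x) (proj₁ y)
    ; hom-∨ = λ x y → hom-∨ (proj₁ x) (proj₁ y)
    ; hom-⊙ = λ x y → hom-⊙ (proj₁ x) (proj₁ y)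
    ; hom-⊕ = λ x y → hom-⊕ (proj₁ x) (proj₁ y)
    ; hom-0 = hom-0
    ; hom-1 = hom-1
    }

isLBSFunctor : ∀ c ℓ (Θ : (A : MVAlgebra c ℓ) → MVAlgebra.Carrier A → Set (c ⊔ ℓ)) →
  (∀ A → InVC A → Closed A (Θ A)) →
  (∀ {A B h} → IsMVHom A B h → MapsInto (Θ A) (Θ B) h) →
  IsLBSFunctor c ℓ Θ
isLBSFunctor c ℓ Θ closed preserved =
    (λ A inVC → closed A inVC , Sub-isLBisemiring A (closed A inVC))
  , (λ A B _ _ h isMVHom →
       preserved isMVHom , MVHomomorphism.restrict-isLBSHom isMVHom (preserved isMVHom))
  , (λ A _ _ _ → MVAlgebra.refl A)
  , (λ _ _ D _ _ _ _ _ _ _ _ _ _ _ → MVAlgebra.refl D)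

mainTheorem5 : (c ℓ : Level) → IsLBSFunctor c ℓ θ × IsLBSFunctor c ℓ θ*
mainTheorem5 c ℓ =
    isLBSFunctor c ℓ θ  ChangVariety.θ-closed  MVHomomorphism.θ-preserved
  , isLBSFunctor c ℓ θ* ChangVariety.θ*-closed MVHomomorphism.θ*-preserved
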